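{- Let $(G_0,\lambda)$ be a temporal graph with lifetime $T$ whose underlying graph $G_0$ has vertex set $\{u,v\}$ and single edge $uv$, and let $\Delta\le T$. For each $i\in\{1,\dots,T\}$ with $uv\in E_i$ let $I_i=\{i-\Delta+1,\dots,i\}\cap\{1,\dots,T-\Delta+1\}$, and let $\mathcal{I}=\{I_i: uv\in E_i\}$. Let $i_1,\dots,i_k$ be such that $uv\in E_{i_j}$ for every $j=1,\dots,k$. Then $\{I_{i_1},\dots,I_{i_k}\}$ is an interval covering of $\mathcal{I}$ (i.e. $\bigcup_{j=1}^k I_{i_j}=\bigcup_{I\in\mathcal{I}}I$) if and only if $\{(u,i_1),\dots,(u,i_k)\}$ is a sliding $\Delta$-window temporal vertex cover of $(G_0,\lambda)$.
   Context: A temporal graph is a pair $(G,\lambda)$ where $G=(V,E)$ is a finite simple undirected graph and $\lambda:E\to 2^{\mathbb{N}}$ assigns to every edge a finite nonempty set of positive integer time labels; lifetime $T=\max\{t:t\in\lambda(e),e\in E\}$; $E_t=\{e:t\in\lambda(e)\}$. A vertex appearance is a pair $(w,t)$, $w\in V$, $t\in\{1,\dots,T\}$; it temporally covers edge $e$ if $w$ is an endpoint of $e$ and $t\in\lambda(e)$. For $t\in\{1,\dots,T-\Delta+1\}$, $W_t=\{t,\dots,t+\Delta-1\}$ and $E[W_t]=\bigcup_{i\in W_t}E_i$. A sliding $\Delta$-window temporal vertex cover is a set $\mathcal{S}$ of vertex appearances such that for every $t\in\{1,\dots,T-\Delta+1\}$ and every $e\in E[W_t]$, some $(w,s)\in\mathcal{S}$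 with $s\in W_t$ temporally covers $e$. -}

module Defs where

open import Data.Nat using (ℕ; _≤_; _<_; _+_; _⊔_)
open import Data.List using (List; []; _∷_; foldr; map)
open import Data.List.Membership.Propositional using (_∈_)
open import Data.List.Relation.Unary.All using (All)
open import Data.Product using (_×_; _,_; proj₂; ∃-syntax; Σ-syntax)
open import Relation.Binary.PropositionalEquality using (_≢_)
open import Function.Bundles using (_⇔_)

-- Vertex set {u, v} of the underlying graph G₀, whose single edge is uv.
data V : Set where
  u v : V

data Endpoint : V → Set where
  end-u : Endpoint u
  end-v : Endpoint v

-- A temporal graph on G₀: the label set λ(uv), finite, nonempty, positive.
record TemporalG₀ : Set where
  constructor mkTG
  field
    labels   : List ℕ
    nonempty : labels ≢ []
    positive : All (λ t → 1 ≤ t) labels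

open TemporalG₀ public

lifetime : TemporalG₀ → ℕ
lifetime G = foldr _⊔_ 0 (labels G)

edgeAt : TemporalG₀ → ℕ → Set
edgeAt G i = i ∈ labels G

Appearance : Set
Appearance = V × ℕ

InWindow : ℕ → ℕ → ℕ → Set
InWindow Δ t s = t ≤ s × s < t + Δ

TempCovers : TemporalG₀ → Appearance → Set
TempCovers G (w , s) = Endpoint w × edgeAt G s

-- Sliding Δ-window temporal vertex cover (G₀ has the single edge uv, so
-- "e ∈ E[W_t]" means: uv ∈ E_i for some i ∈ W_t).
SlidingTVC : TemporalG₀ → ℕ → List Appearance → Set
SlidingTVC G Δ S =
  ∀ t → 1 ≤ t → t + Δ ≤ lifetime G + 1 →
    (∃[ i ] (InWindow Δ t i × edgeAt G i)) →
    ∃[ a ] (a ∈ S × InWindow Δ t (proj₂ a) × TempCovers G a)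

InI : TemporalG₀ → ℕ → ℕ → ℕ → Set
InI G Δ i t = (i < t + Δ × t ≤ i) × (1 ≤ t × t + Δ ≤ lifetime G + 1)

InUnionChosen : TemporalG₀ → ℕ → List ℕ → ℕ → Set
InUnionChosen G Δ is t = ∃[ i ] (i ∈ is × InI G Δ i t)

InUnionAll : TemporalG₀ → ℕ → ℕ → Set
InUnionAll G Δ t = ∃[ i ] (edgeAt G i × InI G Δ i t)

IntervalCovering : TemporalG₀ → ℕ → List ℕ → Set
IntervalCovering G Δ is = ∀ t → InUnionChosen G Δ is t ⇔ InUnionAll G Δ t

module Submission where

-- Both sides of the equivalence talk about the same windows
-- W_t = {t, …, t+Δ-1} with 1 ≤ t ≤ T-Δ+1: a label i lies in W_t exactly
-- when t ∈ I_i (with t admissible).  Hence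
--   * "t is covered by some chosen interval I_{i_j}" says that some chosen
--     label i_j lies in W_t, i.e. that the appearance (u , i_j) lies in W_t;
--     such an appearance temporally covers uv because u is an endpoint and
--     uv ∈ E_{i_j};
--   * "t is covered by some interval of 𝓘" says that W_t contains a label.
-- One inclusion of the interval covering is automatic (every chosen label
-- is a label), so the covering property reduces to: every admissible
-- window containing a label contains a chosen label — which is exactly the
-- sliding-window cover condition for {(u , i_1), …, (u , i_k)}.

open import Defs
open import Data.Nat using (ℕ; _≤_; _+_)
open import Data.List using (List; map)
open import Data.List.Membership.Propositional using (_∈_)
open import Data.List.Membership.Propositional.Properties using (∈-map⁺; ∈-map⁻)
open import Data.List.Relation.Unary.All using (All; lookup)
open import Data.Product using (_×_; _,_; proj₂)
open import Function.Bundles using (_⇔_; mk⇔; Equivalence)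
open import Relation.Binary.PropositionalEquality using (refl)

Admissible : TemporalG₀ → ℕ → ℕ → Set
Admissible G Δ t = 1 ≤ t × t + Δ ≤ lifetime G + 1

inI⇒window : ∀ G {Δ i t} → InI G Δ i t → InWindow Δ t i × Admissible G Δ t
inI⇒window _ ((i<t+Δ , t≤i) , adm) = (t≤i , i<t+Δ) , adm

window⇒inI : ∀ G {Δ i t} → InWindow Δ t i → Admissible G Δ t → InI G Δ i t
window⇒inI _ (t≤i , i<t+Δ) adm = (i<t+Δ , t≤i) , adm

chosen⊆all : ∀ G {Δ is t} → All (edgeAt G) is →
             InUnionChosen G Δ is t → InUnionAll G Δ t
chosen⊆all _ labelled (j , j∈is , t∈Iⱼ) = j , lookup labelled j∈is , t∈Iⱼ

covering-from-⊇ : ∀ G {Δ is} → All (edgeAt G) is →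
                  (∀ t → InUnionAll G Δ t → InUnionChosen G Δ is t) →
                  IntervalCovering G Δ is
covering-from-⊇ G labelled ⊇ t = mk⇔ (chosen⊆all G labelled) (⊇ t)

uAt : List ℕ → List Appearance
uAt is = map (λ i → (u , i)) is

uAt-time : ∀ {is a} → a ∈ uAt is → proj₂ a ∈ is
uAt-time a∈ with ∈-map⁻ (λ i → (u , i)) a∈
... | j , j∈is , refl = j∈is

uAt-covering : ∀ G {is j} → All (edgeAt G) is → j ∈ is →
               (u , j) ∈ uAt is × TempCovers G (u , j)
uAt-covering _ labelled j∈is =
  ∈-map⁺ (λ i → (u , i)) j∈is , end-u , lookup labelled j∈is

lemma5 : (G : TemporalG₀) (Δ : ℕ) → 1 ≤ Δ → Δ ≤ lifetime G →
         (is : List ℕ) → All (edgeAt G) is →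
         IntervalCovering G Δ is ⇔ SlidingTVC G Δ (map (λ i → (u , i)) is)
lemma5 G Δ _ _ is labelled = mk⇔ covering⇒cover cover⇒covering
  where
  covering⇒cover : IntervalCovering G Δ is → SlidingTVC G Δ (uAt is)
  covering⇒cover covering t 1≤t fits (i , i∈Wₜ , uv∈Eᵢ)
    with Equivalence.from (covering t) (i , uv∈Eᵢ , window⇒inI G i∈Wₜ (1≤t , fits))
  ... | j , j∈is , t∈Iⱼ =
    let j∈Wₜ , _ = inI⇒window G t∈Iⱼ
        (u,j∈S , covers) = uAt-covering G labelled j∈is
    in (u , j) , u,j∈S , j∈Wₜ , covers

  cover⇒covering : SlidingTVC G Δ (uAt is) → IntervalCovering G Δ is
  cover⇒covering cover = covering-from-⊇ G labelled ⊇
    where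
    ⊇ : ∀ t → InUnionAll G Δ t → InUnionChosen G Δ is t
    ⊇ t (i , uv∈Eᵢ , t∈Iᵢ) with inI⇒window G t∈Iᵢ
    ... | i∈Wₜ , (1≤t , fits) with cover t 1≤t fits (i , i∈Wₜ , uv∈Eᵢ)
    ... | a , a∈S , s∈Wₜ , _ =
      proj₂ a , uAt-time a∈S , window⇒inI G s∈Wₜ (1≤t , fits)
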